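{- Let $n\geq 3$. The group $U'(n)$ is cyclic if and only if $U(n)$ has an element of order $\frac{\varphi(n)}{2}$.
   Context: $U(n)$ denotes the multiplicative group of units of $\mathbb{Z}/n\mathbb{Z}$ and $\varphi$ is Euler's totient function. For $k\in U(n)$, $[k]=\{x\in\mathbb{Z}\mid x\equiv \pm k\pmod n\}$, and $U'(n)=\{[k]\mid k\in U(n)\}$ is the group with operation $[a]\cdot[b]=[ab]$ (isomorphic to $U(n)/\{\pm1\}$). -}

module Defs where

open import Data.Nat using (ℕ; zero; suc; _+_; _*_; _^_; _≤_; _<_; _/_; _%_)
open import Data.Nat.Coprimality using (Coprime; coprime?)
open import Data.List using (List; length; filter; upTo)
open import Data.Product using (Σ; ∃; _×_)
open import Data.Sum using (_⊎_)
open import Relation.Nullary using (¬_)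
open import Relation.Binary.PropositionalEquality using (_≡_)

_≡_[mod_] : ℕ → ℕ → (n : ℕ) → Set
a ≡ b [mod zero ] = a ≡ b
a ≡ b [mod suc n ] = a % suc n ≡ b % suc n

IsUnit : ℕ → ℕ → Set
IsUnit n k = k < n × Coprime k n

φ : ℕ → ℕ
φ n = length (filter (λ k → coprime? k n) (upTo n))

HasOrder : ℕ → ℕ → ℕ → Set
HasOrder n k m =
  1 ≤ m × (k ^ m) ≡ 1 [mod n ] ×
  (∀ d → 1 ≤ d → d < m → ¬ ((k ^ d) ≡ 1 [mod n ]))

UHasElementOfOrder : ℕ → ℕ → Set
UHasElementOfOrder n m = Σ ℕ λ k → IsUnit n k × HasOrder n k m

-- [a] = [b] in U'(n), i.e. a ≡ ±b (mod n).
_≡±_[mod_] : ℕ → ℕ → (n : ℕ) → Set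
a ≡± b [mod n ] = (a ≡ b [mod n ]) ⊎ ((a + b) ≡ 0 [mod n ])

-- U'(n) is cyclic: some class [g] with g ∈ U(n) generates U'(n),
-- i.e. every class [a], a ∈ U(n), equals [g]^j = [g^j] for some j.
U'Cyclic : ℕ → Set
U'Cyclic n = Σ ℕ λ g → IsUnit n g ×
  (∀ a → IsUnit n a → Σ ℕ λ j → (g ^ j) ≡± a [mod n ])

{-# OPTIONS --safe #-}
-- Let H be the subgroup generated by a unit g of order m; units are counted through the cosets of H.
-- If [g] generates U'(n), every unit is ±gʲ: when -1 ∉ H this gives U(n) = H ⊔ -H, so m = φ(n)/2;
-- when -1 = gᵏ ∈ H it gives U(n) = H, so m = 2k = φ(n) and g² has order φ(n)/2.
-- Conversely let g have order φ(n)/2 (φ(n) is even since u ≠ -u), so U(n) = H ⊔ aH for any a ∉ H and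
-- all squares lie in H. If -1 ∉ H then [g] generates U'(n). Otherwise -1 = gᵏ, and dividing a by a
-- power of g gives b ∉ H with b² = g, so that b generates U(n), or with b² = 1. Then [gb] generates
-- U'(n) when k is odd; when k is even, g^(k/2) is a square root of -1, which lets one write b as a
-- quotient of squares y²/x², forcing b ∈ H.
module Submission where

open import Defs
open import Data.Nat using (ℕ; zero; suc; _+_; _*_; _∸_; _^_; _≤_; _<_; _/_; _%_; _≟_; _≤?_; _<?_; z≤n; s≤s)
open import Data.Nat.Properties
open import Data.Nat.DivMod
open import Data.Nat.Divisibility using (_∣_; divides; ∣1⇒≡1; ∣m⇒∣m*n; ∣n∣m%n⇒∣m; %-presˡ-∣; m%n≡0⇒n∣m)
open import Data.Nat.Coprimality using (coprime?; coprime-Bézout)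
open import Data.Nat.GCD using (module Bézout)
open import Data.Nat.Induction using (<-rec)
open import Data.Nat.Tactic.RingSolver using (solve-∀)
open import Data.Fin using (Fin; zero; suc; toℕ; fromℕ<; splitAt; join)
open import Data.Fin.Properties
  using (toℕ<n; toℕ-fromℕ<; toℕ-injective; splitAt-join; join-splitAt; pigeonhole; injective⇒≤; any?; all?; ¬∀⟶∃¬)
open import Data.List using (List; filter; upTo; lookup)
open import Data.List.Relation.Unary.Any using (index)
open import Data.List.Relation.Unary.Any.Properties using (lookup-index)
import Data.List.Relation.Unary.All as All
open import Data.List.Relation.Unary.AllPairs using (_∷_)
open import Data.List.Relation.Unary.Unique.Propositional using (Unique)
import Data.List.Relation.Unary.Unique.Propositional.Properties as UniqueProperties
open import Data.List.Membership.Propositional.Properties using (∈-filter⁺; ∈-filter⁻; ∈-upTo⁺; ∈-upTo⁻; ∈-lookup)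
open import Data.Product using (Σ; _×_; _,_; proj₁; proj₂)
open import Data.Sum using (_⊎_; inj₁; inj₂)
open import Data.Empty using (⊥-elim)
open import Function.Bundles using (_⇔_; mk⇔)
open import Level using (0ℓ)
open import Relation.Nullary using (¬_; Dec; yes; no)
open import Relation.Nullary.Decidable using (_×-dec_; _→-dec_)
open import Relation.Binary.Bundles using (Setoid)
open import Relation.Binary.Definitions using (tri<; tri≈; tri>)
import Relation.Binary.Reasoning.Setoid
open import Relation.Binary.PropositionalEquality

least-positive : (P : ℕ → Set) → (∀ d → Dec (P d)) → ∀ D → 1 ≤ D → P D →
                 Σ ℕ λ d → 1 ≤ d × P d × (∀ e → 1 ≤ e → e < d → ¬ P e)
least-positive P P? = <-rec Goal search
  where
  Goal : ℕ → Set
  Goal D = 1 ≤ D → P D → Σ ℕ λ d → 1 ≤ d × P d × (∀ e → 1 ≤ e → e < d → ¬ P e)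
  search : ∀ D → (∀ {E} → E < D → Goal E) → Goal D
  search D smaller 1≤D pD with any? {n = D} (λ i → (1 ≤? toℕ i) ×-dec P? (toℕ i))
  ... | yes (i , 1≤i , pi) = smaller (toℕ<n i) 1≤i pi
  ... | no ∄ = D , 1≤D , pD , λ e 1≤e e<D pe →
    ∄ (fromℕ< e<D , subst (λ z → 1 ≤ z × P z) (sym (toℕ-fromℕ< e<D)) (1≤e , pe))

^-distribʳ-* : ∀ a b j → (a * b) ^ j ≡ a ^ j * b ^ j
^-distribʳ-* a b zero    = refl
^-distribʳ-* a b (suc j) = trans (cong (a * b *_) (^-distribʳ-* a b j)) (interchange a b (a ^ j) (b ^ j))
  where
  interchange : ∀ a b c d → a * b * (c * d) ≡ a * c * (b * d)
  interchange = solve-∀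

[m+m]/2≡m : ∀ m → (m + m) / 2 ≡ m
[m+m]/2≡m m = trans (cong (_/ 2) (trans (cong (m +_) (sym (+-identityʳ m))) (*-comm 2 m))) (m*n/n≡m m 2)

m∣x∧0<x<m+m⇒x≡m : ∀ {m x} → m ∣ x → 0 < x → x < m + m → x ≡ m
m∣x∧0<x<m+m⇒x≡m     (divides zero          refl) () _
m∣x∧0<x<m+m⇒x≡m {m} (divides (suc zero)    refl) _  _      = +-identityʳ m
m∣x∧0<x<m+m⇒x≡m {m} (divides (suc (suc q)) refl) _  x<m+m =
  ⊥-elim (<-irrefl refl (<-≤-trans x<m+m (+-monoʳ-≤ m (m≤m+n m (q * m)))))

module Modular (n₀ : ℕ) where
  n : ℕ
  n = suc n₀

  -1# : ℕ
  -1# = n₀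

  infix 4 _≈_
  -- A data type rather than a synonym for a % n ≡ b % n, so that a and b can be inferred.
  data _≈_ (a b : ℕ) : Set where
    mk : a % n ≡ b % n → a ≈ b

  unmk : ∀ {a b} → a ≈ b → a % n ≡ b % n
  unmk (mk p) = p

  ≈-refl : ∀ {a} → a ≈ a
  ≈-refl = mk refl

  ≈-sym : ∀ {a b} → a ≈ b → b ≈ a
  ≈-sym (mk p) = mk (sym p)

  ≈-trans : ∀ {a b c} → a ≈ b → b ≈ c → a ≈ c
  ≈-trans (mk p) (mk q) = mk (trans p q)

  ≡⇒≈ : ∀ {a b} → a ≡ b → a ≈ b
  ≡⇒≈ e = mk (cong (_% n) e)

  ≈-setoid : Setoid 0ℓ 0ℓ
  ≈-setoid = record
    { Carrier = ℕ ; _≈_ = _≈_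
    ; isEquivalence = record { refl = ≈-refl ; sym = ≈-sym ; trans = ≈-trans } }

  module ≈-Reasoning = Relation.Binary.Reasoning.Setoid ≈-setoid

  +-cong : ∀ {a a′ b b′} → a ≈ a′ → b ≈ b′ → a + b ≈ a′ + b′
  +-cong {a} {a′} {b} {b′} (mk p) (mk q) = mk (begin
    (a + b) % n             ≡⟨ %-distribˡ-+ a b n ⟩
    (a % n + b % n) % n     ≡⟨ cong₂ (λ x y → (x + y) % n) p q ⟩
    (a′ % n + b′ % n) % n   ≡⟨ %-distribˡ-+ a′ b′ n ⟨
    (a′ + b′) % n           ∎)
    where open ≡-Reasoning

  *-cong : ∀ {a a′ b b′} → a ≈ a′ → b ≈ b′ → a * b ≈ a′ * b′
  *-cong {a} {a′} {b} {b′} (mk p) (mk q) = mk (begin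
    (a * b) % n               ≡⟨ %-distribˡ-* a b n ⟩
    (a % n * (b % n)) % n     ≡⟨ cong₂ (λ x y → (x * y) % n) p q ⟩
    (a′ % n * (b′ % n)) % n   ≡⟨ %-distribˡ-* a′ b′ n ⟨
    (a′ * b′) % n             ∎)
    where open ≡-Reasoning

  +-congˡ : ∀ c {a b} → a ≈ b → c + a ≈ c + b
  +-congˡ c = +-cong (≈-refl {c})

  +-congʳ : ∀ c {a b} → a ≈ b → a + c ≈ b + c
  +-congʳ c p = +-cong p (≈-refl {c})

  *-congˡ : ∀ c {a b} → a ≈ b → c * a ≈ c * b
  *-congˡ c = *-cong (≈-refl {c})

  *-congʳ : ∀ c {a b} → a ≈ b → a * c ≈ b * c
  *-congʳ c p = *-cong p (≈-refl {c})

  ^-congˡ : ∀ j {a b} → a ≈ b → a ^ j ≈ b ^ j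
  ^-congˡ zero    p = ≈-refl
  ^-congˡ (suc j) p = *-cong p (^-congˡ j p)

  m%n≈m : ∀ a → a % n ≈ a
  m%n≈m a = mk (m%n%n≡m%n a n)

  m+kn≈m : ∀ a k → a + k * n ≈ a
  m+kn≈m a k = mk ([m+kn]%n≡m%n a k n)

  n≈0 : n ≈ 0
  n≈0 = mk (n%n≡0 n)

  ≈⇒≡ : ∀ {a b} → a < n → b < n → a ≈ b → a ≡ b
  ≈⇒≡ a<n b<n (mk e) = trans (sym (m<n⇒m%n≡m a<n)) (trans e (m<n⇒m%n≡m b<n))

  ≈⇒≡+[m/n]*n : ∀ {a c} → c < n → a ≈ c → a ≡ c + (a / n) * n
  ≈⇒≡+[m/n]*n {a} c<n (mk e) =
    trans (m≡m%n+[m/n]*n a n) (cong (_+ (a / n) * n) (trans e (m<n⇒m%n≡m c<n)))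

  +-cancelˡ-≈ : ∀ a {b c} → a + b ≈ a + c → b ≈ c
  +-cancelˡ-≈ a {b} {c} e = begin
    b                  ≈⟨ m+kn≈m b a ⟨
    b + a * n          ≡⟨ shift b a n₀ ⟩
    n₀ * a + (a + b)   ≈⟨ +-congˡ (n₀ * a) e ⟩
    n₀ * a + (a + c)   ≡⟨ shift c a n₀ ⟨
    c + a * n          ≈⟨ m+kn≈m c a ⟩
    c                  ∎
    where
    open ≈-Reasoning
    shift : ∀ x a k → x + a * suc k ≡ k * a + (a + x)
    shift = solve-∀

  x+[-1]x≈0 : ∀ a → a + -1# * a ≈ 0
  x+[-1]x≈0 a = ≈-trans (≡⇒≈ (*-comm n a)) (m+kn≈m 0 a)

  [-1]²≈1 : -1# * -1# ≈ 1
  [-1]²≈1 = +-cancelˡ-≈ n₀ (≈-trans (x+[-1]x≈0 n₀) (≈-trans (≈-sym n≈0) (≡⇒≈ (+-comm 1 n₀))))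

  [-1]*[-1]*x≈x : ∀ a → -1# * (-1# * a) ≈ a
  [-1]*[-1]*x≈x a = ≈-trans (≡⇒≈ (sym (*-assoc n₀ n₀ a))) (≈-trans (*-congʳ a [-1]²≈1) (≡⇒≈ (+-identityʳ a)))

  x≈[-1]y⇒x+y≈0 : ∀ {x y} → x ≈ -1# * y → x + y ≈ 0
  x≈[-1]y⇒x+y≈0 {x} {y} e = ≈-trans (+-congʳ y e) (≈-trans (≡⇒≈ (+-comm (n₀ * y) y)) (x+[-1]x≈0 y))

  x+y≈0⇒y≈[-1]x : ∀ {x y} → x + y ≈ 0 → y ≈ -1# * x
  x+y≈0⇒y≈[-1]x {x} e = +-cancelˡ-≈ x (≈-trans e (≈-sym (x+[-1]x≈0 x)))

  Invertible : ℕ → Set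
  Invertible a = Σ ℕ λ w → a * w ≈ 1

  *-invertible : ∀ {a b} → Invertible a → Invertible b → Invertible (a * b)
  *-invertible {a} {b} (w , aw≈1) (v , bv≈1) =
    w * v , ≈-trans (≡⇒≈ (interchange a b w v)) (*-cong aw≈1 bv≈1)
    where
    interchange : ∀ a b w v → a * b * (w * v) ≡ a * w * (b * v)
    interchange = solve-∀

  ≈-invertible : ∀ {a b} → a ≈ b → Invertible b → Invertible a
  ≈-invertible {a} e (w , bw≈1) = w , ≈-trans (*-congʳ w e) bw≈1

  square-invertible⇒invertible : ∀ {a} → Invertible (a * a) → Invertible a
  square-invertible⇒invertible {a} (w , p) = a * w , ≈-trans (≡⇒≈ (sym (*-assoc a a w))) p

  ^-invertible : ∀ {a} j → Invertible a → Invertible (a ^ j)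
  ^-invertible zero    _ = 1 , ≈-refl
  ^-invertible {a} (suc j) u = *-invertible {a} {a ^ j} u (^-invertible j u)

  -1-invertible : Invertible -1#
  -1-invertible = -1# , [-1]²≈1

  *-cancelˡ-≈ : ∀ {a x y} → Invertible a → a * x ≈ a * y → x ≈ y
  *-cancelˡ-≈ {a} {x} {y} (w , aw≈1) e = begin
    x             ≡⟨ *-identityʳ x ⟨
    x * 1         ≈⟨ *-congˡ x aw≈1 ⟨
    x * (a * w)   ≡⟨ rearrange x a w ⟩
    (a * x) * w   ≈⟨ *-congʳ w e ⟩
    (a * y) * w   ≡⟨ rearrange y a w ⟨
    y * (a * w)   ≈⟨ *-congˡ y aw≈1 ⟩
    y * 1         ≡⟨ *-identityʳ y ⟩
    y             ∎
    where
    open ≈-Reasoning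
    rearrange : ∀ x a w → x * (a * w) ≡ (a * x) * w
    rearrange = solve-∀

  isUnit⇒invertible : ∀ {k} → IsUnit n k → Invertible k
  isUnit⇒invertible {k} (_ , k⊥n) with coprime-Bézout k⊥n
  ... | Bézout.+- x y 1+yn≡xk = x , ≈-trans (≡⇒≈ (trans (*-comm k x) (sym 1+yn≡xk))) (m+kn≈m 1 y)
  ... | Bézout.-+ x y 1+xk≡yn = x * -1# , (begin
    k * (x * -1#)   ≡⟨ rearrange k x n₀ ⟩
    (x * k) * -1#   ≈⟨ *-congʳ -1# xk≈-1 ⟩
    -1# * -1#       ≈⟨ [-1]²≈1 ⟩
    1               ∎)
    where
    open ≈-Reasoning
    rearrange : ∀ k x c → k * (x * c) ≡ (x * k) * c
    rearrange = solve-∀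
    xk≈-1 : x * k ≈ -1#
    xk≈-1 = +-cancelˡ-≈ 1 (≈-trans (≡⇒≈ 1+xk≡yn) (≈-trans (m+kn≈m 0 y) (≈-sym n≈0)))

  invertible⇒isUnit : ∀ a → Invertible a → IsUnit n (a % n)
  invertible⇒isUnit a (w , mk aw≡1) = m%n<n a n , λ {d} (d∣a%n , d∣n) →
    ∣1⇒≡1 (∣n∣m%n⇒∣m d∣n (subst (d ∣_) aw≡1 (%-presˡ-∣ {m = a * w} (∣m⇒∣m*n w (∣n∣m%n⇒∣m {m = a} d∣n d∣a%n)) d∣n)))

  ^-cancel : ∀ {a i j} → Invertible a → i ≤ j → a ^ i ≈ a ^ j → a ^ (j ∸ i) ≈ 1
  ^-cancel {a} {i} {j} a-inv i≤j e = *-cancelˡ-≈ {a ^ i} (^-invertible i a-inv) (begin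
    a ^ i * a ^ (j ∸ i)   ≡⟨ ^-distribˡ-+-* a i (j ∸ i) ⟨
    a ^ (i + (j ∸ i))     ≡⟨ cong (a ^_) (m+[n∸m]≡n i≤j) ⟩
    a ^ j                 ≈⟨ e ⟨
    a ^ i                 ≡⟨ *-identityʳ (a ^ i) ⟨
    a ^ i * 1             ∎)
    where open ≈-Reasoning

  x≉[-1]x : 3 ≤ n → ∀ {a} → Invertible a → ¬ a ≈ -1# * a
  x≉[-1]x n≥3 {a} a-inv a≈-a = 2≢0 (unmk (*-cancelˡ-≈ {a} {2} {0} a-inv (begin
    a * 2          ≡⟨ double a ⟨
    a + a          ≈⟨ +-congˡ a a≈-a ⟩
    a + -1# * a    ≈⟨ x+[-1]x≈0 a ⟩
    0              ≡⟨ *-zeroʳ a ⟨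
    a * 0          ∎)))
    where
    open ≈-Reasoning
    double : ∀ a → a + a ≡ a * 2
    double = solve-∀
    2≢0 : ¬ 2 % n ≡ 0 % n
    2≢0 e with trans (sym (m<n⇒m%n≡m {m = 2} n≥3)) e
    ... | ()

  -1≉1 : 3 ≤ n → ¬ -1# ≈ 1
  -1≉1 n≥3 e = 3≰2 (subst (λ z → 3 ≤ suc z) (≈⇒≡ ≤-refl (≤-trans (s≤s (s≤s z≤n)) n≥3) e) n≥3)
    where
    3≰2 : ¬ 3 ≤ 2
    3≰2 (s≤s (s≤s ()))

  infix 4 _≈?_
  _≈?_ : ∀ a b → Dec (a ≈ b)
  a ≈? b with a % n ≟ b % n
  ... | yes e = yes (mk e)
  ... | no ≢ = no λ e → ≢ (unmk e)

  order-exists : ∀ {a} → Invertible a → Σ ℕ (HasOrder n a)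
  order-exists {a} a-inv with pigeonhole (n<1+n n) (λ (i : Fin (suc n)) → fromℕ< (m%n<n (a ^ toℕ i) n))
  ... | i , j , i<j , e =
    let d , 1≤d , a^d≈1 , minimal = least-positive (λ d → a ^ d ≈ 1) (λ d → a ^ d ≈? 1) (toℕ j ∸ toℕ i)
                                      (m<n⇒0<n∸m i<j) (^-cancel a-inv (<⇒≤ i<j) a^i≈a^j)
    in d , 1≤d , unmk a^d≈1 , λ d′ 1≤d′ d′<d a^d′≡1 → minimal d′ 1≤d′ d′<d (mk a^d′≡1)
    where
    a^i≈a^j : a ^ toℕ i ≈ a ^ toℕ j
    a^i≈a^j = mk (trans (sym (toℕ-fromℕ< (m%n<n (a ^ toℕ i) n))) (trans (cong toℕ e) (toℕ-fromℕ< (m%n<n (a ^ toℕ j) n))))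

  order-of-square : ∀ {a} k → HasOrder n a (k + k) → HasOrder n (a * a % n) k
  order-of-square zero (() , _)
  order-of-square {a} k@(suc _) (_ , a^2k≡1 , minimal) =
    s≤s z≤n , unmk (≈-trans (power k) (mk {b = 1} a^2k≡1)) ,
    λ e 1≤e e<k r → minimal (e + e) (≤-trans 1≤e (m≤m+n e e)) (+-mono-< e<k e<k) (unmk (≈-trans (≈-sym (power e)) (mk {b = 1} r)))
    where
    power : ∀ e → (a * a % n) ^ e ≈ a ^ (e + e)
    power e = ≈-trans (^-congˡ e (m%n≈m (a * a))) (≡⇒≈ (trans (^-distribʳ-* a a e) (sym (^-distribˡ-+-* a e e))))

  _∈±⟨_⟩ : ℕ → ℕ → Set
  u ∈±⟨ h ⟩ = Σ ℕ λ j → u ≈ h ^ j ⊎ u ≈ -1# * h ^ j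

  U'Cyclic-intro : ∀ {h} → Invertible h → (∀ u → Invertible u → u ∈±⟨ h ⟩) → U'Cyclic n
  U'Cyclic-intro {h} h-inv generates = h % n , invertible⇒isUnit h h-inv ,
    λ u u-unit → convert (generates u (isUnit⇒invertible u-unit))
    where
    convert : ∀ {u} → u ∈±⟨ h ⟩ → Σ ℕ λ j → ((h % n) ^ j) ≡± u [mod n ]
    convert (j , inj₁ e) = j , inj₁ (unmk (≈-trans (^-congˡ j (m%n≈m h)) (≈-sym e)))
    convert {u} (j , inj₂ e) = j , inj₂ (unmk (≈-trans (+-congʳ u (^-congˡ j (m%n≈m h)))
                                                (≈-trans (≡⇒≈ (+-comm (h ^ j) u)) (x≈[-1]y⇒x+y≈0 e))))

  U'Cyclic-elim : U'Cyclic n → Σ ℕ λ h → IsUnit n h × (∀ u → IsUnit n u → u ∈±⟨ h ⟩)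
  U'Cyclic-elim (h , h-unit , generates) = h , h-unit , λ u u-unit → convert (generates u u-unit)
    where
    convert : ∀ {u} → Σ ℕ (λ j → (h ^ j) ≡± u [mod n ]) → u ∈±⟨ h ⟩
    convert (j , inj₁ e) = j , inj₁ (≈-sym (mk e))
    convert (j , inj₂ e) = j , inj₂ (x+y≈0⇒y≈[-1]x (mk e))

Unique⇒lookup-injective : ∀ {xs : List ℕ} → Unique xs → ∀ i j → lookup xs i ≡ lookup xs j → i ≡ j
Unique⇒lookup-injective (_ ∷ _)    zero    zero    _ = refl
Unique⇒lookup-injective (x∉ ∷ _)   zero    (suc j) e = ⊥-elim (All.lookup x∉ (∈-lookup j) e)
Unique⇒lookup-injective (x∉ ∷ _)   (suc i) zero    e = ⊥-elim (All.lookup x∉ (∈-lookup i) (sym e))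
Unique⇒lookup-injective (_ ∷ uniq) (suc i) (suc j) e = cong suc (Unique⇒lookup-injective uniq i j e)

module Counting (n₀ : ℕ) where
  open Modular n₀

  isUnit? : ∀ k → Dec (IsUnit n k)
  isUnit? k = (k <? n) ×-dec coprime? k n

  units : List ℕ
  units = filter (λ k → coprime? k n) (upTo n)

  lookup-units-isUnit : ∀ i → IsUnit n (lookup units i)
  lookup-units-isUnit i =
    let k∈upTo , k⊥n = ∈-filter⁻ (λ k → coprime? k n) {xs = upTo n} (∈-lookup i) in ∈-upTo⁻ k∈upTo , k⊥n

  index-in-units : ∀ {k} → IsUnit n k → Σ (Fin (φ n)) λ i → lookup units i ≡ k
  index-in-units (k<n , k⊥n) =
    let k∈units = ∈-filter⁺ (λ k → coprime? k n) (∈-upTo⁺ k<n) k⊥n in index k∈units , sym (lookup-index k∈units)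

  record UnitFamily (K : ℕ) : Set where
    field
      elem       : Fin K → ℕ
      invertible : ∀ i → Invertible (elem i)
      injective  : ∀ {i j} → elem i ≈ elem j → i ≡ j

  open UnitFamily

  Covers : ∀ {K} → (Fin K → ℕ) → Set
  Covers {K} f = ∀ u → IsUnit n u → Σ (Fin K) λ i → f i ≈ u

  Avoids : ∀ {K} → (Fin K → ℕ) → ℕ → Set
  Avoids f u = ∀ i → ¬ f i ≈ u

  size≤φ : ∀ {K} (F : UnitFamily K) → K ≤ φ n
  size≤φ {K} F = injective⇒≤ {f = position} λ {i} {j} e → injective F (mk (begin
    elem F i % n                          ≡⟨ proj₂ (index-of i) ⟨
    lookup units (position i)             ≡⟨ cong (lookup units) e ⟩
    lookup units (position j)             ≡⟨ proj₂ (index-of j) ⟩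
    elem F j % n                          ∎))
    where
    open ≡-Reasoning
    index-of : ∀ i → Σ (Fin (φ n)) λ p → lookup units p ≡ elem F i % n
    index-of i = index-in-units (invertible⇒isUnit (elem F i) (invertible F i))
    position : Fin K → Fin (φ n)
    position i = proj₁ (index-of i)

  covers⇒φ≤ : ∀ {K} (f : Fin K → ℕ) → Covers f → φ n ≤ K
  covers⇒φ≤ {K} f cov = injective⇒≤ {f = preimage} λ {i} {j} e →
    Unique⇒lookup-injective (UniqueProperties.filter⁺ (λ k → coprime? k n) (UniqueProperties.upTo⁺ n)) i j
      (≈⇒≡ (proj₁ (lookup-units-isUnit i)) (proj₁ (lookup-units-isUnit j))
        (≈-trans (≈-sym (proj₂ (cov′ i))) (≈-trans (≡⇒≈ (cong f e)) (proj₂ (cov′ j)))))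
    where
    cov′ : ∀ i → Σ (Fin K) λ p → f p ≈ lookup units i
    cov′ i = cov (lookup units i) (lookup-units-isUnit i)
    preimage : Fin (φ n) → Fin K
    preimage i = proj₁ (cov′ i)

  covers-or-misses : ∀ {K} (f : Fin K → ℕ) → Covers f ⊎ Σ ℕ λ u → IsUnit n u × Avoids f u
  covers-or-misses {K} f = decide (all? P?)
    where
    P : Fin n → Set
    P x = IsUnit n (toℕ x) → Σ (Fin K) λ i → f i % n ≡ toℕ x % n
    P? : ∀ x → Dec (P x)
    P? x = isUnit? (toℕ x) →-dec any? (λ i → f i % n ≟ toℕ x % n)
    decide : Dec (∀ x → P x) → Covers f ⊎ Σ ℕ λ u → IsUnit n u × Avoids f u
    decide (yes all) = inj₁ λ u u-unit@(u<n , _) →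
      let i , e = all (fromℕ< u<n) (subst (IsUnit n) (sym (toℕ-fromℕ< u<n)) u-unit)
      in i , mk (trans e (cong (_% n) (toℕ-fromℕ< u<n)))
    decide (no ¬all) with ¬∀⟶∃¬ n P P? ¬all
    ... | x , ¬Px with isUnit? (toℕ x)
    ...   | yes x-unit = inj₂ (toℕ x , x-unit , λ i e → ¬Px (λ _ → i , unmk e))
    ...   | no ¬x-unit = ⊥-elim (¬Px (λ x-unit → ⊥-elim (¬x-unit x-unit)))

  extend : ∀ {K u} (F : UnitFamily K) → Invertible u → Avoids (elem F) u → UnitFamily (suc K)
  extend {K} {u} F u-inv avoids = record { elem = elem′ ; invertible = invertible′ ; injective = injective′ }
    where
    elem′ : Fin (suc K) → ℕ
    elem′ zero    = u
    elem′ (suc i) = elem F i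
    invertible′ : ∀ i → Invertible (elem′ i)
    invertible′ zero    = u-inv
    invertible′ (suc i) = invertible F i
    injective′ : ∀ {i j} → elem′ i ≈ elem′ j → i ≡ j
    injective′ {zero}  {zero}  _ = refl
    injective′ {zero}  {suc j} e = ⊥-elim (avoids j (≈-sym e))
    injective′ {suc i} {zero}  e = ⊥-elim (avoids i e)
    injective′ {suc i} {suc j} e = cong suc (injective F e)

  φ≤size⇒covers : ∀ {K} (F : UnitFamily K) → φ n ≤ K → Covers (elem F)
  φ≤size⇒covers F φ≤K with covers-or-misses (elem F)
  ... | inj₁ cov = cov
  ... | inj₂ (u , u-unit , avoids) =
    ⊥-elim (<-irrefl refl (≤-trans (size≤φ (extend F (isUnit⇒invertible u-unit) avoids)) φ≤K))

  NegationClosed : ∀ {K} → UnitFamily K → Set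
  NegationClosed {K} F = ∀ i → Σ (Fin K) λ j → elem F j ≈ -1# * elem F i

  module _ (n≥3 : 3 ≤ n) where

    extend-by-±u : ∀ {K u} (F : UnitFamily K) → NegationClosed F → Invertible u → Avoids (elem F) u →
                   Σ (UnitFamily (suc (suc K))) NegationClosed
    extend-by-±u {K} {u} F closed u-inv avoids = F₂ , closed₂
      where
      F₁ : UnitFamily (suc K)
      F₁ = extend F u-inv avoids
      avoids-u : Avoids (elem F₁) (-1# * u)
      avoids-u zero    e = x≉[-1]x n≥3 u-inv e
      avoids-u (suc i) e =
        let j , e′ = closed i in avoids j (≈-trans e′ (≈-trans (*-congˡ -1# e) ([-1]*[-1]*x≈x u)))
      F₂ : UnitFamily (suc (suc K))
      F₂ = extend F₁ (*-invertible { -1#} {u} -1-invertible u-inv) avoids-u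
      closed₂ : NegationClosed F₂
      closed₂ zero          = suc zero , ≈-sym ([-1]*[-1]*x≈x u)
      closed₂ (suc zero)    = zero , ≈-refl
      closed₂ (suc (suc i)) = let j , e = closed i in suc (suc j) , e

    -- Units come in pairs {u, -u} (u ≉ -u as n ≥ 3); fuel bounds the number of pairs still to add.
    φ-even-from : ∀ fuel {S} (F : UnitFamily S) → NegationClosed F → Σ ℕ (λ K → S ≡ K + K) →
                  φ n ≤ fuel + S → Σ ℕ λ K → φ n ≡ K + K
    φ-even-from fuel F closed (K , S≡K+K) φ≤ with covers-or-misses (elem F)
    ... | inj₁ cov = K , trans (≤-antisym (covers⇒φ≤ (elem F) cov) (size≤φ F)) S≡K+K
    φ-even-from zero F closed _ φ≤ | inj₂ (u , u-unit , avoids) =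
      let i , e = φ≤size⇒covers F φ≤ u u-unit in ⊥-elim (avoids i e)
    φ-even-from (suc fuel) {S} F closed (K , S≡K+K) φ≤ | inj₂ (u , u-unit , avoids) =
      let F′ , closed′ = extend-by-±u F closed (isUnit⇒invertible u-unit) avoids
      in φ-even-from fuel F′ closed′ (suc K , cong suc (trans (cong suc S≡K+K) (sym (+-suc K K))))
           (≤-trans φ≤ (≤-trans (≤-reflexive (sym (+-suc fuel S))) (+-monoʳ-≤ fuel (n≤1+n (suc S)))))

    φ-even : Σ ℕ λ K → φ n ≡ K + K
    φ-even = φ-even-from (φ n) empty (λ ()) (0 , refl) (≤-reflexive (sym (+-identityʳ (φ n))))
      where
      empty : UnitFamily 0
      empty = record { elem = λ () ; invertible = λ () ; injective = λ { {()} } }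

module Powers (n₀ g m₀ : ℕ) (g-inv : Modular.Invertible n₀ g) (ord : HasOrder (suc n₀) g (suc m₀)) where
  open Modular n₀
  open Counting n₀
  open UnitFamily

  m : ℕ
  m = suc m₀

  g^m≈1 : g ^ m ≈ 1
  g^m≈1 = mk (proj₁ (proj₂ ord))

  g^d≉1 : ∀ {d} → 1 ≤ d → d < m → ¬ g ^ d ≈ 1
  g^d≉1 {d} 1≤d d<m e = proj₂ (proj₂ ord) d 1≤d d<m (unmk e)

  g^-invertible : ∀ j → Invertible (g ^ j)
  g^-invertible j = ^-invertible j g-inv

  g^-+ : ∀ i j → g ^ (i + j) ≈ g ^ i * g ^ j
  g^-+ i j = ≡⇒≈ (^-distribˡ-+-* g i j)

  g^[m*q]≈1 : ∀ q → g ^ (m * q) ≈ 1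
  g^[m*q]≈1 q = ≈-trans (≡⇒≈ (sym (^-*-assoc g m q))) (≈-trans (^-congˡ q g^m≈1) (≡⇒≈ (^-zeroˡ q)))

  g^j≈g^[j%m] : ∀ j → g ^ j ≈ g ^ (j % m)
  g^j≈g^[j%m] j = begin
    g ^ j                              ≡⟨ cong (g ^_) (m≡m%n+[m/n]*n j m) ⟩
    g ^ (j % m + (j / m) * m)          ≈⟨ g^-+ (j % m) _ ⟩
    g ^ (j % m) * g ^ ((j / m) * m)    ≈⟨ *-congˡ (g ^ (j % m)) (≈-trans (≡⇒≈ (cong (g ^_) (*-comm (j / m) m))) (g^[m*q]≈1 (j / m))) ⟩
    g ^ (j % m) * 1                    ≡⟨ *-identityʳ _ ⟩
    g ^ (j % m)                        ∎
    where open ≈-Reasoning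

  order-divides : ∀ {e} → g ^ e ≈ 1 → m ∣ e
  order-divides {e} g^e≈1 = m%n≡0⇒n∣m e m (remainder-zero (e % m) refl)
    where
    remainder-zero : ∀ r → e % m ≡ r → r ≡ 0
    remainder-zero zero    _  = refl
    remainder-zero (suc r) eq = ⊥-elim (g^d≉1 (s≤s z≤n) (subst (_< m) eq (m%n<n e m))
      (≈-trans (≡⇒≈ (cong (g ^_) (sym eq))) (≈-trans (≈-sym (g^j≈g^[j%m] e)) g^e≈1)))

  g^i≉g^j : ∀ {i j} → i < j → j < m → ¬ g ^ i ≈ g ^ j
  g^i≉g^j {i} {j} i<j j<m e =
    g^d≉1 (m<n⇒0<n∸m i<j) (≤-<-trans (m∸n≤m j i) j<m) (^-cancel g-inv (<⇒≤ i<j) e)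

  g^-injective : ∀ {i j} → i < m → j < m → g ^ i ≈ g ^ j → i ≡ j
  g^-injective {i} {j} i<m j<m e with <-cmp i j
  ... | tri< i<j _ _ = ⊥-elim (g^i≉g^j i<j j<m e)
  ... | tri≈ _ i≡j _ = i≡j
  ... | tri> _ _ j<i = ⊥-elim (g^i≉g^j j<i i<m (≈-sym e))

  g⁻ : ℕ → ℕ
  g⁻ t = g ^ (t * m₀)

  g^t*g⁻t≈1 : ∀ t → g ^ t * g⁻ t ≈ 1
  g^t*g⁻t≈1 t = ≈-trans (≈-sym (g^-+ t (t * m₀)))
    (≈-trans (≡⇒≈ (cong (g ^_) (trans (sym (*-suc t m₀)) (*-comm t m)))) (g^[m*q]≈1 t))

  infix 4 _∈⟨g⟩ _∈_·⟨g⟩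

  _∈⟨g⟩ : ℕ → Set
  x ∈⟨g⟩ = Σ ℕ λ j → g ^ j ≈ x

  _∈_·⟨g⟩ : ℕ → ℕ → Set
  x ∈ c ·⟨g⟩ = Σ ℕ λ j → c * g ^ j ≈ x

  ∈⟨g⟩-resp-≈ : ∀ {x y} → x ≈ y → x ∈⟨g⟩ → y ∈⟨g⟩
  ∈⟨g⟩-resp-≈ x≈y (j , e) = j , ≈-trans e x≈y

  ∈⟨g⟩-* : ∀ {x y} → x ∈⟨g⟩ → y ∈⟨g⟩ → x * y ∈⟨g⟩
  ∈⟨g⟩-* (i , eˣ) (j , eʸ) = i + j , ≈-trans (g^-+ i j) (*-cong eˣ eʸ)

  ∈⟨g⟩-cancelʳ : ∀ {c x} → c * x ∈⟨g⟩ → x ∈⟨g⟩ → c ∈⟨g⟩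
  ∈⟨g⟩-cancelʳ {c} {x} (i , eᶜˣ) (j , eˣ) = i + j * m₀ , (begin
    g ^ (i + j * m₀)      ≈⟨ g^-+ i (j * m₀) ⟩
    g ^ i * g⁻ j          ≈⟨ *-congʳ (g⁻ j) (≈-trans eᶜˣ (*-congˡ c (≈-sym eˣ))) ⟩
    c * g ^ j * g⁻ j      ≡⟨ *-assoc c (g ^ j) (g⁻ j) ⟩
    c * (g ^ j * g⁻ j)    ≈⟨ *-congˡ c (g^t*g⁻t≈1 j) ⟩
    c * 1                 ≡⟨ *-identityʳ c ⟩
    c                     ∎)
    where open ≈-Reasoning

  reduce : ∀ j → Σ (Fin m) λ i → g ^ toℕ i ≈ g ^ j
  reduce j = fromℕ< (m%n<n j m) ,
    ≈-trans (≡⇒≈ (cong (g ^_) (toℕ-fromℕ< (m%n<n j m)))) (≈-sym (g^j≈g^[j%m] j))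

  ∈⟨g⟩? : ∀ x → Dec (x ∈⟨g⟩)
  ∈⟨g⟩? x with any? {n = m} (λ i → g ^ toℕ i % n ≟ x % n)
  ... | yes (i , e) = yes (toℕ i , mk e)
  ... | no ∉ = no λ (j , e) → let i , e′ = reduce j in ∉ (i , unmk (≈-trans e′ e))

  g^k≈-1⇒k+k≡m : 3 ≤ n → ∀ {k} → g ^ k ≈ -1# → k < m → k + k ≡ m
  g^k≈-1⇒k+k≡m n≥3 {k} g^k≈-1 k<m = m∣x∧0<x<m+m⇒x≡m (order-divides g^2k≈1) (positive k g^k≈-1) (+-mono-< k<m k<m)
    where
    g^2k≈1 : g ^ (k + k) ≈ 1
    g^2k≈1 = ≈-trans (g^-+ k k) (≈-trans (*-cong g^k≈-1 g^k≈-1) [-1]²≈1)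
    positive : ∀ k → g ^ k ≈ -1# → 0 < k + k
    positive zero    1≈-1 = ⊥-elim (-1≉1 n≥3 (≈-sym 1≈-1))
    positive (suc _) _    = s≤s z≤n

  powers : UnitFamily m
  powers = record
    { elem       = λ i → g ^ toℕ i
    ; invertible = λ i → g^-invertible (toℕ i)
    ; injective  = λ {i} {j} e → toℕ-injective (g^-injective (toℕ<n i) (toℕ<n j) e)
    }

  powers-cover⇒φ≡m : (∀ u → IsUnit n u → u ∈⟨g⟩) → φ n ≡ m
  powers-cover⇒φ≡m cover = ≤-antisym (covers⇒φ≤ (elem powers) cover′) (size≤φ powers)
    where
    cover′ : Covers (elem powers)
    cover′ u u-unit = let j , e = cover u u-unit ; i , e′ = reduce j in i , ≈-trans e′ e

  module Cosets {c : ℕ} (c-inv : Invertible c) (c∉⟨g⟩ : ¬ c ∈⟨g⟩) where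

    coset-elem : Fin m ⊎ Fin m → ℕ
    coset-elem (inj₁ i) = g ^ toℕ i
    coset-elem (inj₂ i) = c * g ^ toℕ i

    coset-invertible : ∀ x → Invertible (coset-elem x)
    coset-invertible (inj₁ i) = g^-invertible (toℕ i)
    coset-invertible (inj₂ i) = *-invertible {c} c-inv (g^-invertible (toℕ i))

    coset-injective : ∀ x y → coset-elem x ≈ coset-elem y → x ≡ y
    coset-injective (inj₁ i) (inj₁ j) e = cong inj₁ (injective powers e)
    coset-injective (inj₂ i) (inj₂ j) e = cong inj₂ (injective powers (*-cancelˡ-≈ {c} c-inv e))
    coset-injective (inj₁ i) (inj₂ j) e = ⊥-elim (c∉⟨g⟩ (∈⟨g⟩-cancelʳ (toℕ i , e) (toℕ j , ≈-refl)))
    coset-injective (inj₂ i) (inj₁ j) e = ⊥-elim (c∉⟨g⟩ (∈⟨g⟩-cancelʳ (toℕ j , ≈-sym e) (toℕ i , ≈-refl)))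

    cosets : UnitFamily (m + m)
    cosets = record
      { elem       = λ x → coset-elem (splitAt m x)
      ; invertible = λ x → coset-invertible (splitAt m x)
      ; injective  = λ {x} {y} e → begin
          x                      ≡⟨ join-splitAt m m x ⟨
          join m m (splitAt m x) ≡⟨ cong (join m m) (coset-injective (splitAt m x) (splitAt m y) e) ⟩
          join m m (splitAt m y) ≡⟨ join-splitAt m m y ⟩
          y                      ∎
      }
      where open ≡-Reasoning

    cosets-cover⇒φ≡m+m : (∀ u → IsUnit n u → u ∈⟨g⟩ ⊎ u ∈ c ·⟨g⟩) → φ n ≡ m + m
    cosets-cover⇒φ≡m+m cover = ≤-antisym (covers⇒φ≤ (elem cosets) cover′) (size≤φ cosets)
      where
      at : ∀ {u} (x : Fin m ⊎ Fin m) → coset-elem x ≈ u → Σ (Fin (m + m)) λ p → elem cosets p ≈ u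
      at {u} x e = join m m x , subst (λ y → coset-elem y ≈ u) (sym (splitAt-join m m x)) e
      cover′ : Covers (elem cosets)
      cover′ u u-unit with cover u u-unit
      ... | inj₁ (j , e) = let i , e′ = reduce j in at (inj₁ i) (≈-trans e′ e)
      ... | inj₂ (j , e) = let i , e′ = reduce j in at (inj₂ i) (≈-trans (*-congˡ c e′) e)

    φ≡m+m⇒cosets-cover : φ n ≡ m + m → ∀ x → Invertible x → x ∈⟨g⟩ ⊎ x ∈ c ·⟨g⟩
    φ≡m+m⇒cosets-cover φ≡m+m x x-inv =
      let p , e = φ≤size⇒covers cosets (≤-reflexive φ≡m+m) (x % n) (invertible⇒isUnit x x-inv)
      in classify (splitAt m p) (≈-trans e (m%n≈m x))
      where
      classify : ∀ y → coset-elem y ≈ x → x ∈⟨g⟩ ⊎ x ∈ c ·⟨g⟩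
      classify (inj₁ i) e = inj₁ (toℕ i , e)
      classify (inj₂ i) e = inj₂ (toℕ i , e)

even-or-odd : ∀ x → Σ ℕ λ k → x ≡ k * 2 ⊎ x ≡ 1 + k * 2
even-or-odd zero = 0 , inj₁ refl
even-or-odd (suc x) with even-or-odd x
... | k , inj₁ refl = k , inj₂ refl
... | k , inj₂ refl = suc k , inj₁ refl

module SquareRootOfMinusOne (n₀ : ℕ) (n≥3 : 3 ≤ suc n₀) where
  open Modular n₀

  RatioOfSquares : ℕ → Set
  RatioOfSquares b = Σ ℕ λ x → Σ ℕ λ y → Invertible x × Invertible y × b * (x * x) ≈ y * y

  x+z≈x : ∀ {x z} → z ≈ 0 → x + z ≈ x
  x+z≈x {x} z≈0 = ≈-trans (+-congˡ x z≈0) (≡⇒≈ (+-identityʳ x))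

  x+z+kn≈x : ∀ {x z} k → z ≈ 0 → x + z + k * n ≈ x
  x+z+kn≈x {x} {z} k z≈0 = ≈-trans (m+kn≈m (x + z) k) (x+z≈x z≈0)

  1+s²≈0 : ∀ {s} → s * s ≈ -1# → 1 + s * s ≈ 0
  1+s²≈0 s²≈-1 = ≈-trans (+-congˡ 1 s²≈-1) n≈0

  1+b²s²≈0 : ∀ {s b} → s * s ≈ -1# → b * b ≈ 1 → 1 + (b * b) * (s * s) ≈ 0
  1+b²s²≈0 s²≈-1 b²≈1 = ≈-trans (+-congˡ 1 (≈-trans (*-cong b²≈1 s²≈-1) (≡⇒≈ (+-identityʳ n₀)))) n≈0

  invertible⇒odd : ∀ {s} h → n ≡ h * 2 → Invertible s → Σ ℕ λ e → s ≡ 1 + e * 2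
  invertible⇒odd {s} h n≡2h (w , sw≈1) with even-or-odd s
  ... | e , inj₂ refl = e , refl
  ... | e , inj₁ refl = ⊥-elim (even≢odd (e * w) ((s * w / n) * h) (begin
    2 * (e * w)                ≡⟨ *-comm 2 (e * w) ⟩
    e * w * 2                  ≡⟨ swap e w ⟩
    e * 2 * w                  ≡⟨ ≈⇒≡+[m/n]*n (≤-trans (s≤s (s≤s z≤n)) n≥3) sw≈1 ⟩
    1 + (s * w / n) * n        ≡⟨ cong (λ z → 1 + (s * w / n) * z) n≡2h ⟩
    1 + (s * w / n) * (h * 2)  ≡⟨ cong suc (*-assoc (s * w / n) h 2) ⟨
    1 + (s * w / n) * h * 2    ≡⟨ cong suc (*-comm (s * w / n * h) 2) ⟩
    1 + 2 * ((s * w / n) * h)  ∎))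
    where
    open ≡-Reasoning
    swap : ∀ e w → e * w * 2 ≡ e * 2 * w
    swap = solve-∀

  -- For n odd take x = 1 + s and y = 1 + b s: then b x² ≈ 2 b s ≈ y².
  ratio-of-squares-odd : ∀ h → n₀ ≡ h * 2 → ∀ {s b} → Invertible s → s * s ≈ -1# → Invertible b → b * b ≈ 1 →
                         RatioOfSquares b
  ratio-of-squares-odd h n₀≡2h {s} {b} s-inv s²≈-1 b-inv b²≈1 = 1 + s , 1 + b * s , x-inv , y-inv , bx²≈y²
    where
    open ≈-Reasoning
    expand-bx² : ∀ b s → b * ((1 + s) * (1 + s)) ≡ b * 2 * s + b * (1 + s * s)
    expand-bx² = solve-∀
    expand-y² : ∀ b s → (1 + b * s) * (1 + b * s) ≡ b * 2 * s + (1 + (b * b) * (s * s))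
    expand-y² = solve-∀
    expand-x² : ∀ s → (1 + s) * (1 + s) ≡ 2 * s + (1 + s * s)
    expand-x² = solve-∀
    bx²≈y² : b * ((1 + s) * (1 + s)) ≈ (1 + b * s) * (1 + b * s)
    bx²≈y² = begin
      b * ((1 + s) * (1 + s))                   ≡⟨ expand-bx² b s ⟩
      b * 2 * s + b * (1 + s * s)               ≈⟨ x+z≈x (≈-trans (*-congˡ b (1+s²≈0 {s} s²≈-1)) (≡⇒≈ (*-zeroʳ b))) ⟩
      b * 2 * s                                 ≈⟨ x+z≈x (1+b²s²≈0 {s} {b} s²≈-1 b²≈1) ⟨
      b * 2 * s + (1 + (b * b) * (s * s))       ≡⟨ expand-y² b s ⟨
      (1 + b * s) * (1 + b * s)                 ∎
    2-inv : Invertible 2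
    2-inv = suc h , ≈-trans (≡⇒≈ (trans (2[1+h]≡1+n h) (cong (λ z → 1 + 1 * suc z) (sym n₀≡2h)))) (m+kn≈m 1 1)
      where
      2[1+h]≡1+n : ∀ h → 2 * suc h ≡ 1 + 1 * suc (h * 2)
      2[1+h]≡1+n = solve-∀
    x-inv : Invertible (1 + s)
    x-inv = square-invertible⇒invertible {1 + s}
      (≈-invertible (≈-trans (≡⇒≈ (expand-x² s)) (x+z≈x (1+s²≈0 {s} s²≈-1))) (*-invertible {2} {s} 2-inv s-inv))
    y-inv : Invertible (1 + b * s)
    y-inv = square-invertible⇒invertible {1 + b * s}
      (≈-invertible (≈-sym bx²≈y²) (*-invertible {b} b-inv (*-invertible {1 + s} {1 + s} x-inv x-inv)))

  odd²≉-1 : ∀ a → n₀ ≡ 3 + a * 4 → ∀ e → ¬ (1 + e * 2) * (1 + e * 2) ≈ -1#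
  odd²≉-1 a n₀≡3+4a e s²≈-1 = 1≢3-mod-4 {e * e + e} {a + q * (1 + a)} (begin
    1 + (e * e + e) * 4                  ≡⟨ odd² e ⟨
    (1 + e * 2) * (1 + e * 2)            ≡⟨ ≈⇒≡+[m/n]*n ≤-refl s²≈-1 ⟩
    n₀ + q * n                           ≡⟨ cong (λ z → z + q * suc z) n₀≡3+4a ⟩
    3 + a * 4 + q * suc (3 + a * 4)      ≡⟨ regroup a q ⟩
    3 + (a + q * (1 + a)) * 4            ∎)
    where
    open ≡-Reasoning
    q : ℕ
    q = (1 + e * 2) * (1 + e * 2) / n
    odd² : ∀ e → (1 + e * 2) * (1 + e * 2) ≡ 1 + (e * e + e) * 4
    odd² = solve-∀
    regroup : ∀ a q → 3 + a * 4 + q * suc (3 + a * 4) ≡ 3 + (a + q * (1 + a)) * 4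
    regroup = solve-∀
    1≢3-mod-4 : ∀ {x y} → 1 + x * 4 ≢ 3 + y * 4
    1≢3-mod-4 {x} {y} eq with trans (sym ([m+kn]%n≡m%n 1 x 4)) (trans (cong (_% 4) eq) ([m+kn]%n≡m%n 3 y 4))
    ... | ()

  -- n = 2 r with r = 1 + 2 a odd. x and y are the witnesses 1 + s and 1 + b s of the odd case
  -- modulo r, shifted by r to make them odd; τ = 2 + r plays the role of 2.
  ratio-of-squares-2-mod-4 : ∀ a → n₀ ≡ 1 + a * 2 * 2 → ∀ e c → let s = 1 + e * 2 ; b = 1 + c * 2 in
                             Invertible s → s * s ≈ -1# → Invertible b → b * b ≈ 1 → RatioOfSquares b
  ratio-of-squares-2-mod-4 a n₀≡1+4a e c s-inv s²≈-1 b-inv b²≈1 = x , y , x-inv , y-inv , bx²≈y²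
    where
    open ≈-Reasoning
    n≡2+4a : n ≡ 2 + a * 2 * 2
    n≡2+4a = cong suc n₀≡1+4a
    x+z+kn′≈x : ∀ {x z} k → z ≈ 0 → x + z + k * (2 + a * 2 * 2) ≈ x
    x+z+kn′≈x {x} {z} k z≈0 = subst (λ N → x + z + k * N ≈ x) n≡2+4a (x+z+kn≈x k z≈0)
    s b x y T τ : ℕ
    s = 1 + e * 2
    b = 1 + c * 2
    x = 1 + (1 + a * 2) + s
    y = 1 + (1 + a * 2) + b * s
    T = (1 + a * 2) + 2 * (1 + (1 + a * 2)) * b * s
    τ = 3 + a * 2
    expand-bx² : ∀ a c e → (1 + c * 2) * ((1 + (1 + a * 2) + (1 + e * 2)) * (1 + (1 + a * 2) + (1 + e * 2))) ≡
      ((1 + a * 2) + 2 * (1 + (1 + a * 2)) * (1 + c * 2) * (1 + e * 2)) + (1 + c * 2) * (1 + (1 + e * 2) * (1 + e * 2))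
        + ((1 + c * 2) + a * (1 + c * 2) + c) * (2 + a * 2 * 2)
    expand-bx² = solve-∀
    expand-y² : ∀ a c e → (1 + (1 + a * 2) + (1 + c * 2) * (1 + e * 2)) * (1 + (1 + a * 2) + (1 + c * 2) * (1 + e * 2)) ≡
      ((1 + a * 2) + 2 * (1 + (1 + a * 2)) * (1 + c * 2) * (1 + e * 2)) + (1 + ((1 + c * 2) * (1 + c * 2)) * ((1 + e * 2) * (1 + e * 2)))
        + (a + 1) * (2 + a * 2 * 2)
    expand-y² = solve-∀
    expand-x² : ∀ a e → (1 + (1 + a * 2) + (1 + e * 2)) * (1 + (1 + a * 2) + (1 + e * 2)) + e * (2 + a * 2 * 2) ≡
      (1 + e * 2) * (3 + a * 2) + (1 + (1 + e * 2) * (1 + e * 2)) + (a + 1 + (1 + e * 2)) * (2 + a * 2 * 2)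
    expand-x² = solve-∀
    bx²≈y² : b * (x * x) ≈ y * y
    bx²≈y² = begin
      b * (x * x)                                                   ≡⟨ expand-bx² a c e ⟩
      T + b * (1 + s * s) + (b + a * b + c) * (2 + a * 2 * 2)       ≈⟨ x+z+kn′≈x (b + a * b + c) (≈-trans (*-congˡ b (1+s²≈0 {s} s²≈-1)) (≡⇒≈ (*-zeroʳ b))) ⟩
      T                                                             ≈⟨ x+z+kn′≈x (a + 1) (1+b²s²≈0 {s} {b} s²≈-1 b²≈1) ⟨
      T + (1 + (b * b) * (s * s)) + (a + 1) * (2 + a * 2 * 2)       ≡⟨ expand-y² a c e ⟨
      y * y                                                         ∎
    τ-inv : Invertible τ
    τ-inv with even-or-odd a
    ... | k , inj₁ refl = a + 1 , ≈-trans (≡⇒≈ (trans (product k) (cong (λ N → 1 + (k + 1) * N) (sym n≡2+4a)))) (m+kn≈m 1 (k + 1))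
      where
      product : ∀ k → (3 + k * 2 * 2) * (k * 2 + 1) ≡ 1 + (k + 1) * (2 + k * 2 * 2 * 2)
      product = solve-∀
    ... | k , inj₂ refl = 3 * a + 2 , ≈-trans (≡⇒≈ (trans (product k) (cong (λ N → 1 + (3 * k + 4) * N) (sym n≡2+4a)))) (m+kn≈m 1 (3 * k + 4))
      where
      product : ∀ k → (3 + (1 + k * 2) * 2) * (3 * (1 + k * 2) + 2) ≡ 1 + (3 * k + 4) * (2 + (1 + k * 2) * 2 * 2)
      product = solve-∀
    x²≈sτ : x * x ≈ s * τ
    x²≈sτ = begin
      x * x                                                   ≈⟨ subst (λ N → x * x + e * N ≈ x * x) n≡2+4a (m+kn≈m (x * x) e) ⟨
      x * x + e * (2 + a * 2 * 2)                             ≡⟨ expand-x² a e ⟩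
      s * τ + (1 + s * s) + (a + 1 + s) * (2 + a * 2 * 2)     ≈⟨ x+z+kn′≈x (a + 1 + s) (1+s²≈0 {s} s²≈-1) ⟩
      s * τ                                                   ∎
    x-inv : Invertible x
    x-inv = square-invertible⇒invertible {x} (≈-invertible x²≈sτ (*-invertible {s} {τ} s-inv τ-inv))
    y-inv : Invertible y
    y-inv = square-invertible⇒invertible {y} (≈-invertible (≈-sym bx²≈y²) (*-invertible {b} {x * x} b-inv (*-invertible {x} {x} x-inv x-inv)))

  ratio-of-squares : ∀ {s b} → Invertible s → s * s ≈ -1# → Invertible b → b * b ≈ 1 → RatioOfSquares b
  ratio-of-squares {s} {b} s-inv s²≈-1 b-inv b²≈1 with even-or-odd n₀
  ... | h , inj₁ n₀≡2h = ratio-of-squares-odd h n₀≡2h {s} {b} s-inv s²≈-1 b-inv b²≈1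
  ... | h , inj₂ n₀≡1+2h
    with invertible⇒odd {s} (suc h) (cong suc n₀≡1+2h) s-inv | invertible⇒odd {b} (suc h) (cong suc n₀≡1+2h) b-inv | even-or-odd h
  ...   | e , refl | c , refl | a , inj₁ refl = ratio-of-squares-2-mod-4 a n₀≡1+2h e c s-inv s²≈-1 b-inv b²≈1
  ...   | e , refl | c , refl | a , inj₂ refl = ⊥-elim (odd²≉-1 a (trans n₀≡1+2h (regroup a)) e s²≈-1)
    where
    regroup : ∀ a → 1 + (1 + a * 2) * 2 ≡ 3 + a * 4
    regroup = solve-∀

module Forward (n₀ : ℕ) (n≥3 : 3 ≤ suc n₀) where
  open Modular n₀

  module Generator {g m₀ : ℕ} (g-unit : IsUnit n g) (ord : HasOrder n g (suc m₀))
                   (generates : ∀ u → IsUnit n u → u ∈±⟨ g ⟩) where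
    g-inv : Invertible g
    g-inv = isUnit⇒invertible g-unit

    open Powers n₀ g m₀ g-inv ord

    φ≡m+m : ¬ -1# ∈⟨g⟩ → φ n ≡ m + m
    φ≡m+m -1∉⟨g⟩ = cosets-cover⇒φ≡m+m cover
      where
      open Cosets -1-invertible -1∉⟨g⟩
      cover : ∀ u → IsUnit n u → u ∈⟨g⟩ ⊎ u ∈ -1# ·⟨g⟩
      cover u u-unit with generates u u-unit
      ... | j , inj₁ e = inj₁ (j , ≈-sym e)
      ... | j , inj₂ e = inj₂ (j , ≈-sym e)

    φ≡m : ∀ {k} → g ^ k ≈ -1# → φ n ≡ m
    φ≡m {k} g^k≈-1 = powers-cover⇒φ≡m cover
      where
      cover : ∀ u → IsUnit n u → u ∈⟨g⟩
      cover u u-unit with generates u u-unit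
      ... | j , inj₁ e = j , ≈-sym e
      ... | j , inj₂ e = k + j , ≈-trans (g^-+ k j) (≈-trans (*-congʳ (g ^ j) g^k≈-1) (≈-sym e))

    element-of-order : UHasElementOfOrder n (φ n / 2)
    element-of-order with ∈⟨g⟩? -1#
    ... | no -1∉⟨g⟩ = g , g-unit , subst (HasOrder n g) (sym φ/2≡m) ord
      where
      φ/2≡m : φ n / 2 ≡ m
      φ/2≡m = trans (cong (_/ 2) (φ≡m+m -1∉⟨g⟩)) ([m+m]/2≡m m)
    ... | yes (j , g^j≈-1) =
      g * g % n , invertible⇒isUnit (g * g) (*-invertible {g} {g} g-inv g-inv) ,
      subst (HasOrder n (g * g % n)) (sym φ/2≡k) (order-of-square k (subst (HasOrder n g) (sym k+k≡m) ord))
      where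
      k : ℕ
      k = toℕ (proj₁ (reduce j))
      g^k≈-1 : g ^ k ≈ -1#
      g^k≈-1 = ≈-trans (proj₂ (reduce j)) g^j≈-1
      k+k≡m : k + k ≡ m
      k+k≡m = g^k≈-1⇒k+k≡m n≥3 g^k≈-1 (toℕ<n (proj₁ (reduce j)))
      φ/2≡k : φ n / 2 ≡ k
      φ/2≡k = trans (cong (_/ 2) (trans (φ≡m {k} g^k≈-1) (sym k+k≡m))) ([m+m]/2≡m k)

  cyclic⇒element-of-order : U'Cyclic n → UHasElementOfOrder n (φ n / 2)
  cyclic⇒element-of-order cyclic = from-generator (U'Cyclic-elim cyclic)
    where
    from-generator : (Σ ℕ λ g → IsUnit n g × (∀ u → IsUnit n u → u ∈±⟨ g ⟩)) → UHasElementOfOrder n (φ n / 2)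
    from-generator (g , g-unit , generates) = from-order (order-exists (isUnit⇒invertible g-unit))
      where
      from-order : Σ ℕ (HasOrder n g) → UHasElementOfOrder n (φ n / 2)
      from-order (zero , () , _)
      from-order (suc m₀ , ord) = Generator.element-of-order g-unit ord generates

module Backward (n₀ : ℕ) (n≥3 : 3 ≤ suc n₀) where
  open Modular n₀
  open Counting n₀
  open SquareRootOfMinusOne n₀ n≥3

  module HalfOrder {g m₀ : ℕ} (g-inv : Invertible g) (ord : HasOrder n g (suc m₀))
                   (φ≡m+m : φ n ≡ suc m₀ + suc m₀) where
    open Powers n₀ g m₀ g-inv ord

    cosets-cover : ∀ {c} → Invertible c → ¬ c ∈⟨g⟩ → ∀ x → Invertible x → x ∈⟨g⟩ ⊎ x ∈ c ·⟨g⟩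
    cosets-cover c-inv c∉⟨g⟩ = Cosets.φ≡m+m⇒cosets-cover c-inv c∉⟨g⟩ φ≡m+m

    generated-if-−1∉⟨g⟩ : ¬ -1# ∈⟨g⟩ → U'Cyclic n
    generated-if-−1∉⟨g⟩ -1∉⟨g⟩ = U'Cyclic-intro g-inv λ u u-inv → classify (cosets-cover -1-invertible -1∉⟨g⟩ u u-inv)
      where
      classify : ∀ {u} → u ∈⟨g⟩ ⊎ u ∈ -1# ·⟨g⟩ → u ∈±⟨ g ⟩
      classify (inj₁ (j , e)) = j , inj₁ (≈-sym e)
      classify (inj₂ (j , e)) = j , inj₂ (≈-sym e)

    outside : Σ ℕ λ a → Invertible a × ¬ a ∈⟨g⟩
    outside with covers-or-misses (UnitFamily.elem powers)
    ... | inj₁ cover = ⊥-elim (<-irrefl refl (<-≤-trans (m<m+n m (s≤s z≤n))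
                                 (≤-trans (≤-reflexive (sym φ≡m+m)) (covers⇒φ≤ _ cover))))
    ... | inj₂ (a , a-unit , avoids) =
      a , isUnit⇒invertible a-unit , λ (j , e) → let i , e′ = reduce j in avoids i (≈-trans e′ e)

    squares∈⟨g⟩ : ∀ {a} → Invertible a → ¬ a ∈⟨g⟩ → ∀ x → Invertible x → x * x ∈⟨g⟩
    squares∈⟨g⟩ {a} a-inv a∉⟨g⟩ x x-inv with cosets-cover a-inv a∉⟨g⟩ x x-inv
    ... | inj₁ x∈⟨g⟩ = ∈⟨g⟩-* x∈⟨g⟩ x∈⟨g⟩
    ... | inj₂ (j , e) = ∈⟨g⟩-resp-≈ (≈-trans (≡⇒≈ (interchange a (g ^ j))) (*-cong e e))
                           (∈⟨g⟩-* a²∈⟨g⟩ (∈⟨g⟩-* (j , ≈-refl) (j , ≈-refl)))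
      where
      interchange : ∀ a y → (a * a) * (y * y) ≡ a * y * (a * y)
      interchange = solve-∀
      a²∈⟨g⟩ : a * a ∈⟨g⟩
      a²∈⟨g⟩ with cosets-cover a-inv a∉⟨g⟩ (a * a) (*-invertible {a} {a} a-inv a-inv)
      ... | inj₁ a²∈ = a²∈
      ... | inj₂ (j , e) = ⊥-elim (a∉⟨g⟩ (j , *-cancelˡ-≈ {a} a-inv e))

    -- Dividing a by g ^ ⌊i/2⌋, where a * a ≈ g ^ i.
    involution-or-root : ∀ {a} → Invertible a → ¬ a ∈⟨g⟩ →
                         Σ ℕ λ b → Invertible b × ¬ b ∈⟨g⟩ × (b * b ≈ 1 ⊎ b * b ≈ g)
    involution-or-root {a} a-inv a∉⟨g⟩ with squares∈⟨g⟩ a-inv a∉⟨g⟩ a a-inv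
    ... | i , g^i≈a² with even-or-odd i
    ...   | t , i≡t2+r = b , b-inv , b∉⟨g⟩ , square i≡t2+r
      where
      b : ℕ
      b = a * g⁻ t
      b-inv : Invertible b
      b-inv = *-invertible {a} a-inv (g^-invertible (t * m₀))
      b∉⟨g⟩ : ¬ b ∈⟨g⟩
      b∉⟨g⟩ b∈⟨g⟩ = a∉⟨g⟩ (∈⟨g⟩-resp-≈ bgᵗ≈a (∈⟨g⟩-* b∈⟨g⟩ (t , ≈-refl)))
        where
        bgᵗ≈a : b * g ^ t ≈ a
        bgᵗ≈a = ≈-trans (≡⇒≈ (*-assoc a (g⁻ t) (g ^ t)))
                  (≈-trans (*-congˡ a (≈-trans (≡⇒≈ (*-comm (g⁻ t) (g ^ t))) (g^t*g⁻t≈1 t))) (≡⇒≈ (*-identityʳ a)))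
      b²≈gʳ : ∀ r → i ≡ r + (t + t) → b * b ≈ g ^ r
      b²≈gʳ r i≡r+2t = begin
        b * b                                      ≡⟨ interchange a (g⁻ t) ⟩
        (a * a) * (g⁻ t * g⁻ t)                    ≈⟨ *-congʳ (g⁻ t * g⁻ t) (≈-sym g^i≈a²) ⟩
        g ^ i * (g⁻ t * g⁻ t)                      ≈⟨ *-congʳ (g⁻ t * g⁻ t) (≈-trans (≡⇒≈ (cong (g ^_) i≡r+2t))
                                                        (≈-trans (g^-+ r (t + t)) (*-congˡ (g ^ r) (g^-+ t t)))) ⟩
        g ^ r * (g ^ t * g ^ t) * (g⁻ t * g⁻ t)    ≡⟨ regroup (g ^ r) (g ^ t) (g⁻ t) ⟩
        g ^ r * ((g ^ t * g⁻ t) * (g ^ t * g⁻ t))  ≈⟨ *-congˡ (g ^ r) (*-cong (g^t*g⁻t≈1 t) (g^t*g⁻t≈1 t)) ⟩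
        g ^ r * 1                                  ≡⟨ *-identityʳ (g ^ r) ⟩
        g ^ r                                      ∎
        where
        open ≈-Reasoning
        interchange : ∀ a y → a * y * (a * y) ≡ (a * a) * (y * y)
        interchange = solve-∀
        regroup : ∀ x y z → x * (y * y) * (z * z) ≡ x * ((y * z) * (y * z))
        regroup = solve-∀
      double : ∀ t → t * 2 ≡ t + t
      double = solve-∀
      square : i ≡ t * 2 ⊎ i ≡ 1 + t * 2 → b * b ≈ 1 ⊎ b * b ≈ g
      square (inj₁ i≡2t)   = inj₁ (b²≈gʳ 0 (trans i≡2t (double t)))
      square (inj₂ i≡1+2t) = inj₂ (≈-trans (b²≈gʳ 1 (trans i≡1+2t (cong suc (double t)))) (≡⇒≈ (*-identityʳ g)))

    generated-by-root : ∀ {b} → Invertible b → ¬ b ∈⟨g⟩ → b * b ≈ g → U'Cyclic n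
    generated-by-root {b} b-inv b∉⟨g⟩ b²≈g = U'Cyclic-intro b-inv λ u u-inv → classify (cosets-cover b-inv b∉⟨g⟩ u u-inv)
      where
      b^[2j]≈g^j : ∀ j → b ^ (2 * j) ≈ g ^ j
      b^[2j]≈g^j j = ≈-trans (≡⇒≈ (sym (^-*-assoc b 2 j))) (^-congˡ j (≈-trans (≡⇒≈ (cong (b *_) (*-identityʳ b))) b²≈g))
      classify : ∀ {u} → u ∈⟨g⟩ ⊎ u ∈ b ·⟨g⟩ → u ∈±⟨ b ⟩
      classify (inj₁ (j , e)) = 2 * j , inj₁ (≈-sym (≈-trans (b^[2j]≈g^j j) e))
      classify (inj₂ (j , e)) = suc (2 * j) , inj₁ (≈-sym (≈-trans (*-congˡ b (b^[2j]≈g^j j)) e))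

    -- For k odd, g ^ j and -g ^ j = g ^ (j + k) have exponents of opposite parity, and the parity
    -- of the exponent of g * b decides whether the factor b appears.
    generated-by-g*b : ∀ {k z b} → g ^ k ≈ -1# → k ≡ 1 + z * 2 → Invertible b → ¬ b ∈⟨g⟩ → b * b ≈ 1 → U'Cyclic n
    generated-by-g*b {k} {z} {b} g^k≈-1 k≡1+2z b-inv b∉⟨g⟩ b²≈1 =
      U'Cyclic-intro (*-invertible {g} {b} g-inv b-inv) λ u u-inv → classify (cosets-cover b-inv b∉⟨g⟩ u u-inv)
      where
      open ≈-Reasoning
      h : ℕ
      h = g * b
      b^[2y]≈1 : ∀ y → b ^ (y * 2) ≈ 1
      b^[2y]≈1 y = ≈-trans (≡⇒≈ (trans (cong (b ^_) (*-comm y 2)) (sym (^-*-assoc b 2 y))))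
                     (≈-trans (^-congˡ y (≈-trans (≡⇒≈ (cong (b *_) (*-identityʳ b))) b²≈1)) (≡⇒≈ (^-zeroˡ y)))
      h^[2y]≈g^[2y] : ∀ y → h ^ (y * 2) ≈ g ^ (y * 2)
      h^[2y]≈g^[2y] y = ≈-trans (≡⇒≈ (^-distribʳ-* g b (y * 2)))
                          (≈-trans (*-congˡ (g ^ (y * 2)) (b^[2y]≈1 y)) (≡⇒≈ (*-identityʳ _)))
      h^[1+2y]≈g^[1+2y]*b : ∀ y → h ^ (1 + y * 2) ≈ g ^ (1 + y * 2) * b
      h^[1+2y]≈g^[1+2y]*b y = ≈-trans (*-congˡ h (h^[2y]≈g^[2y] y)) (≡⇒≈ (swap g b (g ^ (y * 2))))
        where
        swap : ∀ g b x → g * b * x ≡ g * x * b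
        swap = solve-∀
      g^[j+k]≈-g^j : ∀ j → g ^ (j + k) ≈ -1# * g ^ j
      g^[j+k]≈-g^j j = ≈-trans (g^-+ j k) (≈-trans (*-congˡ (g ^ j) g^k≈-1) (≡⇒≈ (*-comm (g ^ j) -1#)))
      negated : ∀ {u} x → h ^ x ≈ -1# * u → u ∈±⟨ h ⟩
      negated {u} x e = x , inj₂ (≈-trans (≈-sym ([-1]*[-1]*x≈x u)) (*-congˡ -1# (≈-sym e)))
      odd+odd : ∀ y z → 1 + y * 2 + (1 + z * 2) ≡ (1 + y + z) * 2
      odd+odd = solve-∀
      even+odd : ∀ y z → y * 2 + (1 + z * 2) ≡ 1 + (y + z) * 2
      even+odd = solve-∀
      in-⟨g⟩ : ∀ {u} j → g ^ j ≈ u → Σ ℕ (λ y → j ≡ y * 2 ⊎ j ≡ 1 + y * 2) → u ∈±⟨ h ⟩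
      in-⟨g⟩ j e (y , inj₁ refl) = j , inj₁ (≈-sym (≈-trans (h^[2y]≈g^[2y] y) e))
      in-⟨g⟩ {u} j e (y , inj₂ refl) = negated (j + k) (begin
        h ^ (j + k)              ≡⟨ cong (h ^_) j+k≡ ⟩
        h ^ ((1 + y + z) * 2)    ≈⟨ h^[2y]≈g^[2y] (1 + y + z) ⟩
        g ^ ((1 + y + z) * 2)    ≡⟨ cong (g ^_) j+k≡ ⟨
        g ^ (j + k)              ≈⟨ g^[j+k]≈-g^j j ⟩
        -1# * g ^ j              ≈⟨ *-congˡ -1# e ⟩
        -1# * u                  ∎)
        where
        j+k≡ : j + k ≡ (1 + y + z) * 2
        j+k≡ = trans (cong (j +_) k≡1+2z) (odd+odd y z)
      in-b⟨g⟩ : ∀ {u} j → b * g ^ j ≈ u → Σ ℕ (λ y → j ≡ y * 2 ⊎ j ≡ 1 + y * 2) → u ∈±⟨ h ⟩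
      in-b⟨g⟩ j e (y , inj₂ refl) =
        j , inj₁ (≈-sym (≈-trans (h^[1+2y]≈g^[1+2y]*b y) (≈-trans (≡⇒≈ (*-comm (g ^ j) b)) e)))
      in-b⟨g⟩ {u} j e (y , inj₁ refl) = negated (j + k) (begin
        h ^ (j + k)                ≡⟨ cong (h ^_) j+k≡ ⟩
        h ^ (1 + (y + z) * 2)      ≈⟨ h^[1+2y]≈g^[1+2y]*b (y + z) ⟩
        g ^ (1 + (y + z) * 2) * b  ≡⟨ cong (λ x → g ^ x * b) j+k≡ ⟨
        g ^ (j + k) * b            ≈⟨ *-congʳ b (g^[j+k]≈-g^j j) ⟩
        -1# * g ^ j * b            ≡⟨ rearrange -1# (g ^ j) b ⟩
        -1# * (b * g ^ j)          ≈⟨ *-congˡ -1# e ⟩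
        -1# * u                    ∎)
        where
        j+k≡ : j + k ≡ 1 + (y + z) * 2
        j+k≡ = trans (cong (j +_) k≡1+2z) (even+odd y z)
        rearrange : ∀ c x b → c * x * b ≡ c * (b * x)
        rearrange = solve-∀
      classify : ∀ {u} → u ∈⟨g⟩ ⊎ u ∈ b ·⟨g⟩ → u ∈±⟨ h ⟩
      classify (inj₁ (j , e)) = in-⟨g⟩ j e (even-or-odd j)
      classify (inj₂ (j , e)) = in-b⟨g⟩ j e (even-or-odd j)

    -- For k even, g ^ (k / 2) is a square root of -1; then b is a ratio of squares, and squares lie in ⟨g⟩.
    no-involution-outside : ∀ {k z b} → g ^ k ≈ -1# → k ≡ z * 2 → Invertible b → ¬ b ∈⟨g⟩ → ¬ b * b ≈ 1
    no-involution-outside {k} {z} {b} g^k≈-1 k≡2z b-inv b∉⟨g⟩ b²≈1 =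
      let x , y , x-inv , y-inv , bx²≈y² = ratio-of-squares {g ^ z} {b} (g^-invertible z) s²≈-1 b-inv b²≈1
      in b∉⟨g⟩ (∈⟨g⟩-cancelʳ (∈⟨g⟩-resp-≈ (≈-sym bx²≈y²) (squares∈⟨g⟩ b-inv b∉⟨g⟩ y y-inv))
                              (squares∈⟨g⟩ b-inv b∉⟨g⟩ x x-inv))
      where
      double : ∀ z → z + z ≡ z * 2
      double = solve-∀
      s²≈-1 : g ^ z * g ^ z ≈ -1#
      s²≈-1 = ≈-trans (≈-sym (g^-+ z z)) (≈-trans (≡⇒≈ (cong (g ^_) (trans (double z) (sym k≡2z)))) g^k≈-1)

    cyclic : U'Cyclic n
    cyclic = by-cases (∈⟨g⟩? -1#)
      where
      from-involution-or-root : ∀ {k} → g ^ k ≈ -1# →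
                                (Σ ℕ λ b → Invertible b × ¬ b ∈⟨g⟩ × (b * b ≈ 1 ⊎ b * b ≈ g)) → U'Cyclic n
      from-involution-or-root _ (b , b-inv , b∉⟨g⟩ , inj₂ b²≈g) = generated-by-root b-inv b∉⟨g⟩ b²≈g
      from-involution-or-root {k} g^k≈-1 (b , b-inv , b∉⟨g⟩ , inj₁ b²≈1) = by-parity (even-or-odd k)
        where
        by-parity : Σ ℕ (λ z → k ≡ z * 2 ⊎ k ≡ 1 + z * 2) → U'Cyclic n
        by-parity (z , inj₁ k≡2z)   = ⊥-elim (no-involution-outside {k} {z} g^k≈-1 k≡2z b-inv b∉⟨g⟩ b²≈1)
        by-parity (z , inj₂ k≡1+2z) = generated-by-g*b {k} {z} g^k≈-1 k≡1+2z b-inv b∉⟨g⟩ b²≈1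
      by-cases : Dec (-1# ∈⟨g⟩) → U'Cyclic n
      by-cases (no -1∉⟨g⟩)          = generated-if-−1∉⟨g⟩ -1∉⟨g⟩
      by-cases (yes (k , g^k≈-1)) =
        let a , a-inv , a∉⟨g⟩ = outside in from-involution-or-root {k} g^k≈-1 (involution-or-root a-inv a∉⟨g⟩)

  element-of-order⇒cyclic : UHasElementOfOrder n (φ n / 2) → U'Cyclic n
  element-of-order⇒cyclic (g , g-unit , ord) = from-order (φ n / 2) ord refl
    where
    from-order : ∀ m → HasOrder n g m → m ≡ φ n / 2 → U'Cyclic n
    from-order zero (() , _) _
    from-order (suc m₀) ord m≡φ/2 = HalfOrder.cyclic (isUnit⇒invertible g-unit) ord φ≡m+m
      where
      φ≡m+m : φ n ≡ suc m₀ + suc m₀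
      φ≡m+m = let K , φ≡K+K = φ-even n≥3 in
        trans φ≡K+K (cong (λ x → x + x) (sym (trans m≡φ/2 (trans (cong (_/ 2) φ≡K+K) ([m+m]/2≡m K)))))

mainTheorem6 : (n : ℕ) → 3 ≤ n → U'Cyclic n ⇔ UHasElementOfOrder n (φ n / 2)
mainTheorem6 zero    ()
mainTheorem6 (suc n₀) n≥3 =
  mk⇔ (Forward.cyclic⇒element-of-order n₀ n≥3) (Backward.element-of-order⇒cyclic n₀ n≥3)
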